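{- Let $k\geq 2$. Every bipartite graph $G$ with $d(G)\geq k$ contains a subgraph $H$ with vertex classes $A$ and $B$ such that $d(H)\geq k/4$, $d_H(v)\leq k$ for each $v\in A$, and either (1) $|A|\geq k^6|B|$, or (2) $\Delta(H)\leq k^7$.
   Context: $d(G)=2e(G)/|V(G)|$ is the average degree, $d_H(v)$ is the degree of $v$ in $H$, and $\Delta(H)$ is the maximum degree of $H$.
   Formalization: The parameter k ranges over the rationals. -}

module Defs where

open import Data.Bool using (Bool; true; false; if_then_else_; _∧_)
open import Data.Nat using (ℕ; zero; suc; _+_; _*_; _<_)
open import Data.Fin using (Fin; zero; suc; toℕ)
open import Data.Integer using (+_)
open import Data.Rational using (ℚ; _/_; 1ℚ; 0ℚ)
import Data.Rational as ℚ
open import Data.Empty using (⊥)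
open import Relation.Binary.PropositionalEquality using (_≡_; _≢_)
open import Relation.Nullary using (¬_; Dec; yes; no)
open import Data.Nat using (_<?_)

ℕ→ℚ : ℕ → ℚ
ℕ→ℚ n = (+ n) / 1

_^ℚ_ : ℚ → ℕ → ℚ
q ^ℚ zero = 1ℚ
q ^ℚ suc m = q ℚ.* (q ^ℚ m)

count : ∀ {n} → (Fin n → Bool) → ℕ
count {zero} p = 0
count {suc n} p = (if p zero then 1 else 0) + count {n} (λ i → p (suc i))

record Graph (n : ℕ) : Set where
  field
    adj   : Fin n → Fin n → Bool
    sym   : ∀ u v → adj u v ≡ adj v u
    irrefl : ∀ v → adj v v ≡ false
open Graph public

IsBipartite : ∀ {n} → Graph n → Set
IsBipartite {n} G = Σ' (Fin n → Bool) λ c → ∀ u v → adj G u v ≡ true → c u ≢ c v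
  where
  open import Data.Product using () renaming (Σ to Σ')

deg : ∀ {n} → Graph n → Fin n → ℕ
deg G v = count (adj G v)

-- number of edges: unordered pairs {u,v}, counted as u < v
isLess : ∀ {n} → Fin n → Fin n → Bool
isLess u v with toℕ u <? toℕ v
... | yes _ = true
... | no _ = false

sumF : ∀ {n} → (Fin n → ℕ) → ℕ
sumF {zero} f = 0
sumF {suc n} f = f zero + sumF {n} (λ i → f (suc i))

edges : ∀ {n} → Graph n → ℕ
edges G = sumF (λ u → count (λ v → isLess u v ∧ adj G u v))

-- average degree 2e/|V| of a graph with e edges on m vertices
-- (the paper leaves it undefined for m = 0; we set it to 0 there)
avgDeg : ℕ → ℕ → ℚ
avgDeg e zero = 0ℚ
avgDeg e (suc m) = (+ (2 * e)) / suc m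

d : ∀ {n} → Graph n → ℚ
d {n} G = avgDeg (edges G) n

-- a subgraph H of G: a vertex subset inV together with a graph on the
-- same ground set whose edges are edges of G with both ends in inV
record Subgraph {n : ℕ} (G : Graph n) : Set where
  field
    inV   : Fin n → Bool
    H     : Graph n
    sub   : ∀ u v → adj H u v ≡ true → adj G u v ≡ true
    ends  : ∀ u v → adj H u v ≡ true → inV u ≡ true
open Subgraph public

vH : ∀ {n} {G : Graph n} → Subgraph G → ℕ
vH S = count (inV S)

dH : ∀ {n} {G : Graph n} → Subgraph G → ℚ
dH S = avgDeg (edges (H S)) (vH S)

module Submission where

-- Write k = P / Q.  Deleting vertices of degree below k/2 one at a time never lowers the
-- average degree below k, so G has an induced subgraph G[S] with an edge and minimum degree
-- at least k/2; orient the bipartition so that the class A of S is at least as large as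
-- the class B.  Letting each vertex of A keep only its first ⌊k⌋ neighbours puts every
-- A-degree in [k/2, k], so the e kept edges satisfy k|A|/2 ≤ e ≤ k|A|.  Split B into the
-- vertices of degree above k^7 and the rest, B_lo.  If at least k|A|/4 kept edges end in
-- B_lo, then A ∪ B_lo has average degree at least k/4 (as |B_lo| ≤ |A|) and maximum degree
-- at most k^7.  Otherwise more than k|A|/4 kept edges end in B_hi = B ∖ B_lo, and
-- k^7 |B_hi| ≤ e ≤ k|A| gives |A| ≥ k^6 |B_hi|, so A ∪ B_hi has average degree at least k/4.

open import Defs

module Combinatorics where

  import Data.Bool as Bool
  open import Data.Bool using (Bool; true; false; _∧_; _∨_; not; if_then_else_)
  open import Data.Bool.Properties
    using (not-involutive; not-injective; ¬-not; ∧-zeroʳ; ∧-identityʳ; ∧-comm; ∨-comm; ∨-identityʳ; ∨-zeroʳ)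
  open import Data.Nat as ℕ using (ℕ; zero; suc; _+_; _*_; _≤_; _<_; _⊓_; _^_; z≤n; s≤s; NonZero)
  import Data.Nat.Properties as ℕₚ
  open import Algebra.Properties.Semiring.Sum ℕₚ.+-*-semiring
    using (sum; ∑-distrib-+; ∑-comm; sum-replicate-zero; *-distribˡ-sum; sum-cong-≗)
  open import Data.Nat.DivMod using (_/_; _%_; m≡m%n+[m/n]*n; m%n<n; m/n*n≤m; m≥n⇒m/n>0)
  open import Data.Nat.Solver using (module +-*-Solver)
  open +-*-Solver using (solve; _:*_; _:+_; con; _:=_)
  open import Data.Fin using (Fin; zero; suc; toℕ)
  open import Data.Fin.Properties using (_≟_; toℕ-injective; any?)
  open import Data.Product using (Σ; ∃; _×_; _,_; proj₁; proj₂)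
  open import Data.Sum as Sum using (_⊎_; inj₁; inj₂)
  open import Data.Empty using (⊥-elim)
  open import Function using (_∘_)
  open import Relation.Nullary using (¬_; Dec; yes; no; does)
  open import Relation.Nullary.Decidable using (_×-dec_)
  open import Relation.Binary.PropositionalEquality
    using (_≡_; _≢_; refl; cong; cong₂; trans; subst; subst₂; module ≡-Reasoning)
    renaming (sym to ≡-sym)

  does⇒ : ∀ {X : Set} (x? : Dec X) → does x? ≡ true → X
  does⇒ (yes x) _ = x

  not-does⇒¬ : ∀ {X : Set} (x? : Dec X) → not (does x?) ≡ true → ¬ X
  not-does⇒¬ (no ¬x) _ = ¬x

  ∧-true : ∀ {x y} → x ∧ y ≡ true → x ≡ true × y ≡ true
  ∧-true {true} {true} _ = refl , refl

  m<n*o⇒0<n : ∀ {m} n o → m < n * o → 0 < n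
  m<n*o⇒0<n (suc n) o _ = s≤s z≤n

  0<m+n∧n≤m⇒0<m : ∀ {m n} → 0 < m + n → n ≤ m → 0 < m
  0<m+n∧n≤m⇒0<m {suc m} _ _ = s≤s z≤n
  0<m+n∧n≤m⇒0<m {zero} {suc n} _ ()

  m≤2n*[m/n] : ∀ m n .{{_ : NonZero n}} → n ≤ m → m ≤ (2 * n) * (m / n)
  m≤2n*[m/n] m n n≤m = begin
    m                          ≡⟨ m≡m%n+[m/n]*n m n ⟩
    m % n + m / n * n          ≤⟨ ℕₚ.+-monoˡ-≤ (m / n * n) (ℕₚ.<⇒≤ (m%n<n m n)) ⟩
    n + m / n * n              ≤⟨ ℕₚ.+-monoˡ-≤ (m / n * n) (ℕₚ.m≤n*m n (m / n) {{ℕ.>-nonZero (m≥n⇒m/n>0 n≤m)}}) ⟩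
    m / n * n + m / n * n      ≡⟨ solve 2 (λ n t → t :* n :+ t :* n := (con 2 :* n) :* t) refl n (m / n) ⟩
    (2 * n) * (m / n)          ∎
    where open ℕₚ.≤-Reasoning

  Qx≤P⇒xQ^≤P^ : ∀ {Q P x} → Q * x ≤ P → Q ≤ P → ∀ m → x * Q ^ suc m ≤ P ^ suc m
  Qx≤P⇒xQ^≤P^ {Q} {P} {x} Qx≤P Q≤P m = begin
    x * (Q * Q ^ m)  ≡⟨ solve 3 (λ x Q Qᵐ → x :* (Q :* Qᵐ) := (Q :* x) :* Qᵐ) refl x Q (Q ^ m) ⟩
    (Q * x) * Q ^ m  ≤⟨ ℕₚ.*-mono-≤ Qx≤P (ℕₚ.^-monoˡ-≤ m Q≤P) ⟩
    P * P ^ m        ∎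
    where open ℕₚ.≤-Reasoning

  ⟦_⟧ : Bool → ℕ
  ⟦ b ⟧ = if b then 1 else 0

  sumOver : ∀ {n} → (Fin n → Bool) → (Fin n → ℕ) → ℕ
  sumOver p f = sum λ i → if p i then f i else 0

  sumF≡sum : ∀ {n} (f : Fin n → ℕ) → sumF f ≡ sum f
  sumF≡sum {zero} f = refl
  sumF≡sum {suc n} f = cong (f zero +_) (sumF≡sum (λ i → f (suc i)))

  count≡sum : ∀ {n} (p : Fin n → Bool) → count p ≡ sum (λ i → ⟦ p i ⟧)
  count≡sum {zero} p = refl
  count≡sum {suc n} p = cong (⟦ p zero ⟧ +_) (count≡sum (λ i → p (suc i)))

  sum-mono : ∀ {n} {f g : Fin n → ℕ} → (∀ i → f i ≤ g i) → sum f ≤ sum g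
  sum-mono {zero} f≤g = z≤n
  sum-mono {suc n} f≤g = ℕₚ.+-mono-≤ (f≤g zero) (sum-mono (λ i → f≤g (suc i)))

  sum-pos : ∀ {n} (f : Fin n → ℕ) → 0 < sum f → ∃ λ i → 0 < f i
  sum-pos {suc n} f 0<∑f with f zero in f0≡
  ... | suc _ = zero , subst (0 <_) (≡-sym f0≡) (s≤s z≤n)
  ... | zero with sum-pos (λ i → f (suc i)) 0<∑f
  ...   | i , 0<fi = suc i , 0<fi

  ⟦∧⟧ : ∀ x y → ⟦ x ∧ y ⟧ ≡ (if x then ⟦ y ⟧ else 0)
  ⟦∧⟧ true y = refl
  ⟦∧⟧ false y = refl

  ∑∑-distrib-+ : ∀ {m n} (f g : Fin m → Fin n → ℕ) →
    sum (λ i → sum λ j → f i j + g i j) ≡ sum (λ i → sum (f i)) + sum (λ i → sum (g i))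
  ∑∑-distrib-+ f g = trans (sum-cong-≗ λ i → ∑-distrib-+ (f i) (g i)) (∑-distrib-+ (λ i → sum (f i)) (λ i → sum (g i)))

  count-cong : ∀ {n} {p q : Fin n → Bool} → (∀ i → p i ≡ q i) → count p ≡ count q
  count-cong {zero} p≗q = refl
  count-cong {suc n} p≗q = cong₂ _+_ (cong ⟦_⟧ (p≗q zero)) (count-cong (λ i → p≗q (suc i)))

  count-pos : ∀ {n} (p : Fin n → Bool) → 0 < count p → ∃ λ i → p i ≡ true
  count-pos p 0<#p with sum-pos (λ i → ⟦ p i ⟧) (subst (0 <_) (count≡sum p) 0<#p)
  ... | i , 0<⟦pi⟧ with p i in pi≡
  ...   | true = i , pi≡
  ...   | false with () ← 0<⟦pi⟧

  count-mono : ∀ {n} {p q : Fin n → Bool} → (∀ i → p i ≡ true → q i ≡ true) → count p ≤ count q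
  count-mono {zero} p⊆q = z≤n
  count-mono {suc n} {p} {q} p⊆q = ℕₚ.+-mono-≤ head≤ (count-mono (λ i → p⊆q (suc i)))
    where
    head≤ : ⟦ p zero ⟧ ≤ ⟦ q zero ⟧
    head≤ with p zero in p0≡
    ... | false = z≤n
    ... | true rewrite p⊆q zero p0≡ = ℕₚ.≤-refl

  sumOver-mono : ∀ {n} (p : Fin n → Bool) {f g : Fin n → ℕ} →
    (∀ i → p i ≡ true → f i ≤ g i) → sumOver p f ≤ sumOver p g
  sumOver-mono p {f} {g} f≤g = sum-mono pointwise
    where
    pointwise : ∀ i → (if p i then f i else 0) ≤ (if p i then g i else 0)
    pointwise i with p i in pi≡
    ... | true = f≤g i pi≡
    ... | false = z≤n

  sumOver-cong : ∀ {n} (p : Fin n → Bool) {f g : Fin n → ℕ} →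
    (∀ i → p i ≡ true → f i ≡ g i) → sumOver p f ≡ sumOver p g
  sumOver-cong p {f} {g} f≗g = sum-cong-≗ pointwise
    where
    pointwise : ∀ i → (if p i then f i else 0) ≡ (if p i then g i else 0)
    pointwise i with p i in pi≡
    ... | true = f≗g i pi≡
    ... | false = refl

  sumOver-*ˡ : ∀ {n} (p : Fin n → Bool) c (f : Fin n → ℕ) → sumOver p (λ i → c * f i) ≡ c * sumOver p f
  sumOver-*ˡ p c f = trans (sum-cong-≗ pointwise) (≡-sym (*-distribˡ-sum c (λ i → if p i then f i else 0)))
    where
    pointwise : ∀ i → (if p i then c * f i else 0) ≡ c * (if p i then f i else 0)
    pointwise i with p i
    ... | true = refl
    ... | false = ≡-sym (ℕₚ.*-zeroʳ c)

  sumOver-const : ∀ {n} (p : Fin n → Bool) c → sumOver p (λ _ → c) ≡ c * count p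
  sumOver-const p c = begin
    sumOver p (λ _ → c)     ≡⟨ sumOver-cong p (λ _ _ → ≡-sym (ℕₚ.*-identityʳ c)) ⟩
    sumOver p (λ _ → c * 1) ≡⟨ sumOver-*ˡ p c (λ _ → 1) ⟩
    c * sum (λ i → ⟦ p i ⟧) ≡⟨ cong (c *_) (count≡sum p) ⟨
    c * count p ∎
    where open ≡-Reasoning

  sumOver-split : ∀ {n} (p q : Fin n → Bool) (f : Fin n → ℕ) →
    sumOver p f ≡ sumOver (λ i → p i ∧ q i) f + sumOver (λ i → p i ∧ not (q i)) f
  sumOver-split p q f = trans (sum-cong-≗ pointwise)
    (∑-distrib-+ (λ i → if p i ∧ q i then f i else 0) (λ i → if p i ∧ not (q i) then f i else 0))
    where
    pointwise : ∀ i → (if p i then f i else 0)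
                    ≡ (if p i ∧ q i then f i else 0) + (if p i ∧ not (q i) then f i else 0)
    pointwise i with p i | q i
    ... | true  | true  = ≡-sym (ℕₚ.+-identityʳ (f i))
    ... | true  | false = refl
    ... | false | _     = refl

  count-split : ∀ {n} (p q : Fin n → Bool) → count p ≡ count (λ i → p i ∧ q i) + count (λ i → p i ∧ not (q i))
  count-split {n} p q = begin
    count p                   ≡⟨ count≡sum p ⟩
    sumOver p (λ _ → 1)       ≡⟨ sumOver-split p q (λ _ → 1) ⟩
    sumOver p∧q (λ _ → 1) + sumOver p∧¬q (λ _ → 1) ≡⟨ cong₂ _+_ (count≡sum p∧q) (count≡sum p∧¬q) ⟨
    count p∧q + count p∧¬q ∎
    where
    open ≡-Reasoning
    p∧q p∧¬q : Fin n → Bool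
    p∧q i = p i ∧ q i
    p∧¬q i = p i ∧ not (q i)

  count-∧ : ∀ {n} (p q : Fin n → Bool) → count (λ i → p i ∧ q i) ≡ sumOver q (λ i → ⟦ p i ⟧)
  count-∧ p q = trans (count≡sum (λ i → p i ∧ q i)) (sum-cong-≗ λ i → trans (cong ⟦_⟧ (∧-comm (p i) (q i))) (⟦∧⟧ (q i) (p i)))

  sumOver-singleton : ∀ {n} (w : Fin n) (f : Fin n → ℕ) → sumOver (λ i → does (i ≟ w)) f ≡ f w
  sumOver-singleton {suc n} zero f = trans (cong (f zero +_) (sum-replicate-zero n)) (ℕₚ.+-identityʳ (f zero))
  sumOver-singleton {suc n} (suc w) f = sumOver-singleton w (λ i → f (suc i))

  count-false : ∀ n → count {n} (λ _ → false) ≡ 0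
  count-false n = trans (count≡sum {n} (λ _ → false)) (sum-replicate-zero n)

  count-true : ∀ n → count {n} (λ _ → true) ≡ n
  count-true zero = refl
  count-true (suc n) = cong suc (count-true n)

  degreeSum : ∀ {n} → Graph n → ℕ
  degreeSum G = sum (deg G)

  adjacent⇒≢ : ∀ {n} (G : Graph n) {u v} → adj G u v ≡ true → u ≢ v
  adjacent⇒≢ G {u} uv refl with () ← trans (≡-sym uv) (irrefl G u)

  isLess-exclusive : ∀ {n} {u v : Fin n} → u ≢ v → ⟦ isLess u v ⟧ + ⟦ isLess v u ⟧ ≡ 1
  isLess-exclusive {u = u} {v} u≢v with toℕ u ℕ.<? toℕ v | toℕ v ℕ.<? toℕ u
  ... | yes u<v | yes v<u = ⊥-elim (ℕₚ.<-asym u<v v<u)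
  ... | yes _   | no _    = refl
  ... | no _    | yes _   = refl
  ... | no u≮v  | no v≮u  = ⊥-elim (u≢v (toℕ-injective (ℕₚ.≤∧≮⇒≡ (ℕₚ.≮⇒≥ v≮u) u≮v)))

  adj-split : ∀ {n} (G : Graph n) u v →
    ⟦ adj G u v ⟧ ≡ ⟦ isLess u v ∧ adj G u v ⟧ + ⟦ isLess v u ∧ adj G u v ⟧
  adj-split G u v with adj G u v in uv
  ... | false = ≡-sym (cong₂ (λ x y → ⟦ x ⟧ + ⟦ y ⟧) (∧-zeroʳ (isLess u v)) (∧-zeroʳ (isLess v u)))
  ... | true  = ≡-sym (trans (cong₂ (λ x y → ⟦ x ⟧ + ⟦ y ⟧) (∧-identityʳ (isLess u v)) (∧-identityʳ (isLess v u)))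
                             (isLess-exclusive (adjacent⇒≢ G uv)))

  handshake : ∀ {n} (G : Graph n) → degreeSum G ≡ 2 * edges G
  handshake {n} G = begin
    sum (deg G)                               ≡⟨ sum-cong-≗ (λ u → count≡sum (adj G u)) ⟩
    sum (λ u → sum λ v → ⟦ adj G u v ⟧)       ≡⟨ sum-cong-≗ (λ u → sum-cong-≗ (adj-split G u)) ⟩
    sum (λ u → sum λ v → lower u v + upper u v) ≡⟨ ∑∑-distrib-+ lower upper ⟩
    X + sum (λ u → sum (upper u))             ≡⟨ cong (X +_) (∑-comm upper) ⟩
    X + sum (λ v → sum λ u → upper u v)       ≡⟨ cong (X +_) (sum-cong-≗ λ v → sum-cong-≗ λ u → cong (λ b → ⟦ isLess v u ∧ b ⟧) (Graph.sym G u v)) ⟩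
    X + X                                     ≡⟨ cong (X +_) (ℕₚ.+-identityʳ X) ⟨
    2 * X                                     ≡⟨ cong (2 *_) (trans (sumF≡sum (λ u → count (λ v → isLess u v ∧ adj G u v))) (sum-cong-≗ λ u → count≡sum (λ v → isLess u v ∧ adj G u v))) ⟨
    2 * edges G                               ∎
    where
    open ≡-Reasoning
    lower upper : Fin n → Fin n → ℕ
    lower u v = ⟦ isLess u v ∧ adj G u v ⟧
    upper u v = ⟦ isLess v u ∧ adj G u v ⟧
    X : ℕ
    X = sum (λ u → sum (lower u))

  sumOver-deg≡∑∑ : ∀ {n} (G : Graph n) (p : Fin n → Bool) →
    sumOver p (deg G) ≡ sum (λ u → sum λ v → ⟦ p u ∧ adj G u v ⟧)
  sumOver-deg≡∑∑ {n} G p = sum-cong-≗ λ u → row (p u) u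
    where
    row : ∀ b u → (if b then deg G u else 0) ≡ sum (λ v → ⟦ b ∧ adj G u v ⟧)
    row true u = count≡sum (adj G u)
    row false u = ≡-sym (sum-replicate-zero n)

  sumOver-deg≡∑∑ʳ : ∀ {n} (G : Graph n) (p : Fin n → Bool) →
    sumOver p (deg G) ≡ sum (λ u → sum λ v → ⟦ p v ∧ adj G u v ⟧)
  sumOver-deg≡∑∑ʳ G p = begin
    sumOver p (deg G)                          ≡⟨ sumOver-deg≡∑∑ G p ⟩
    sum (λ v → sum λ u → ⟦ p v ∧ adj G v u ⟧)  ≡⟨ sum-cong-≗ (λ v → sum-cong-≗ λ u → cong (λ b → ⟦ p v ∧ b ⟧) (Graph.sym G v u)) ⟩
    sum (λ v → sum λ u → ⟦ p v ∧ adj G u v ⟧)  ≡⟨ ∑-comm (λ v u → ⟦ p v ∧ adj G u v ⟧) ⟩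
    sum (λ u → sum λ v → ⟦ p v ∧ adj G u v ⟧)  ∎
    where open ≡-Reasoning

  sumOver-deg-transfer : ∀ {n} (G : Graph n) (p q : Fin n → Bool) →
    (∀ u v → adj G u v ≡ true → p u ≡ q v) → sumOver p (deg G) ≡ sumOver q (deg G)
  sumOver-deg-transfer G p q p∼q = begin
    sumOver p (deg G)                          ≡⟨ sumOver-deg≡∑∑ G p ⟩
    sum (λ u → sum λ v → ⟦ p u ∧ adj G u v ⟧)  ≡⟨ sum-cong-≗ (λ u → sum-cong-≗ (λ v → cong ⟦_⟧ (endpoints u v))) ⟩
    sum (λ u → sum λ v → ⟦ q v ∧ adj G u v ⟧)  ≡⟨ sumOver-deg≡∑∑ʳ G q ⟨
    sumOver q (deg G)                          ∎
    where
    open ≡-Reasoning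
    endpoints : ∀ u v → p u ∧ adj G u v ≡ q v ∧ adj G u v
    endpoints u v with adj G u v in uv
    ... | true  = trans (∧-identityʳ (p u)) (trans (p∼q u v uv) (≡-sym (∧-identityʳ (q v))))
    ... | false = trans (∧-zeroʳ (p u)) (≡-sym (∧-zeroʳ (q v)))

  bipartite-edges≡sumOver-deg : ∀ {n} (G : Graph n) (side : Fin n → Bool) →
    (∀ u v → adj G u v ≡ true → side u ≢ side v) → edges G ≡ sumOver (λ v → not (side v)) (deg G)
  bipartite-edges≡sumOver-deg G side crossing = ℕₚ.*-cancelˡ-≡ (edges G) X 2 (begin
    2 * edges G               ≡⟨ handshake G ⟨
    degreeSum G               ≡⟨ sumOver-split (λ _ → true) side (deg G) ⟩
    sumOver side (deg G) + X  ≡⟨ cong (_+ X) (sumOver-deg-transfer G side (λ v → not (side v)) (λ u v uv → ¬-not (crossing u v uv))) ⟩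
    X + X                     ≡⟨ cong (X +_) (ℕₚ.+-identityʳ X) ⟨
    2 * X                     ∎)
    where
    open ≡-Reasoning
    X : ℕ
    X = sumOver (λ v → not (side v)) (deg G)

  -- Induced subgraphs and a core of large minimum degree

  induced : ∀ {n} → Graph n → (Fin n → Bool) → Graph n
  induced G S = record
    { adj    = λ u v → (S u ∧ S v) ∧ adj G u v
    ; sym    = λ u v → cong₂ _∧_ (∧-comm (S u) (S v)) (Graph.sym G u v)
    ; irrefl = λ v → trans (cong ((S v ∧ S v) ∧_) (irrefl G v)) (∧-zeroʳ (S v ∧ S v))
    }

  module _ {n} (G : Graph n) (S : Fin n → Bool) where

    induced-⊆ : ∀ u v → adj (induced G S) u v ≡ true → adj G u v ≡ true
    induced-⊆ u v uv with S u | S v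
    ... | true | true = uv

    induced-inside : ∀ u v → adj (induced G S) u v ≡ true → S u ≡ true
    induced-inside u v uv with S u | S v
    ... | true | true = refl

    deg-induced-≤ : ∀ v → deg (induced G S) v ≤ deg G v
    deg-induced-≤ v = count-mono λ w vw → induced-⊆ v w vw

    deg-induced-outside : ∀ v → S v ≡ false → deg (induced G S) v ≡ 0
    deg-induced-outside v Sv rewrite Sv = count-false n

    deg-induced-closed : ∀ v → S v ≡ true → (∀ w → adj G v w ≡ true → S w ≡ true) →
      deg (induced G S) v ≡ deg G v
    deg-induced-closed v Sv closed = count-cong keep
      where
      keep : ∀ w → (S v ∧ S w) ∧ adj G v w ≡ adj G v w
      keep w with adj G v w in vw
      ... | false = ∧-zeroʳ (S v ∧ S w)
      ... | true rewrite Sv | closed w vw = refl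

  _∖_ : ∀ {n} → (Fin n → Bool) → (Fin n → Bool) → Fin n → Bool
  (S ∖ L) i = S i ∧ not (L i)

  degreeSum-removal : ∀ {n} (G : Graph n) (S L : Fin n → Bool) →
    degreeSum (induced G S) ≤ degreeSum (induced G (S ∖ L)) + 2 * sumOver L (deg (induced G S))
  degreeSum-removal {n} G S L = begin
    degreeSum GS                                 ≡⟨ sumOver-deg≡∑∑ GS (λ _ → true) ⟩
    sum (λ u → sum λ v → ⟦ adj GS u v ⟧)         ≤⟨ sum-mono (λ u → sum-mono λ v → pointwise (S u) (S v) (L u) (L v) (adj G u v)) ⟩
    sum (λ u → sum λ v → ⟦ adj GS' u v ⟧ + (first u v + second u v))
      ≡⟨ ∑∑-distrib-+ (λ u v → ⟦ adj GS' u v ⟧) (λ u v → first u v + second u v) ⟩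
    sum (λ u → sum λ v → ⟦ adj GS' u v ⟧) + sum (λ u → sum λ v → first u v + second u v)
      ≡⟨ cong₂ _+_ (≡-sym (sumOver-deg≡∑∑ GS' (λ _ → true))) (∑∑-distrib-+ first second) ⟩
    degreeSum GS' + (sum (λ u → sum (first u)) + sum (λ u → sum (second u)))
      ≡⟨ cong₂ (λ x y → degreeSum GS' + (x + y)) (sumOver-deg≡∑∑ GS L) (sumOver-deg≡∑∑ʳ GS L) ⟨
    degreeSum GS' + (D + D)
      ≡⟨ cong (λ y → degreeSum GS' + (D + y)) (ℕₚ.+-identityʳ D) ⟨
    degreeSum GS' + 2 * D                        ∎
    where
    open ℕₚ.≤-Reasoning
    GS GS' : Graph n
    GS = induced G S
    GS' = induced G (S ∖ L)
    first second : Fin n → Fin n → ℕ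
    first u v = ⟦ L u ∧ adj GS u v ⟧
    second u v = ⟦ L v ∧ adj GS u v ⟧
    D : ℕ
    D = sumOver L (deg GS)
    -- an edge of G[S] survives in G[S ∖ L] unless one of its ends lies in L
    pointwise : ∀ x y p q b →
      ⟦ (x ∧ y) ∧ b ⟧ ≤ ⟦ ((x ∧ not p) ∧ (y ∧ not q)) ∧ b ⟧ + (⟦ p ∧ ((x ∧ y) ∧ b) ⟧ + ⟦ q ∧ ((x ∧ y) ∧ b) ⟧)
    pointwise false y p q b = z≤n
    pointwise true false p q b = z≤n
    pointwise true true true q b = ℕₚ.m≤m+n ⟦ b ⟧ _
    pointwise true true false true b = ℕₚ.≤-refl
    pointwise true true false false b = ℕₚ.m≤m+n ⟦ b ⟧ 0

  singleton : ∀ {n} → Fin n → Fin n → Bool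
  singleton w i = does (i ≟ w)

  count-remove : ∀ {n} (S : Fin n → Bool) w → S w ≡ true → count S ≡ suc (count (S ∖ singleton w))
  count-remove S w Sw = trans (count-split S (singleton w))
    (cong (_+ count (S ∖ singleton w)) (trans (count-∧ S (singleton w)) (trans (sumOver-singleton w (λ i → ⟦ S i ⟧)) (cong ⟦_⟧ Sw))))

  module _ {n} (G : Graph n) (P Q : ℕ) where

    removal-keeps-dense : ∀ S w → S w ≡ true → 2 * deg (induced G S) w * Q < P →
      P * count S ≤ degreeSum (induced G S) * Q →
      P * count (S ∖ singleton w) < degreeSum (induced G (S ∖ singleton w)) * Q
    removal-keeps-dense S w Sw low dense = ℕₚ.+-cancelˡ-< P _ _ (begin-strict
      P + P * c'                   ≡⟨ ℕₚ.*-suc P c' ⟨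
      P * suc c'                   ≡⟨ cong (P *_) (count-remove S w Sw) ⟨
      P * count S                  ≤⟨ dense ⟩
      degreeSum (induced G S) * Q  ≤⟨ ℕₚ.*-monoˡ-≤ Q (degreeSum-removal G S (singleton w)) ⟩
      (D' + 2 * sumOver (singleton w) (deg (induced G S))) * Q
        ≡⟨ cong (λ x → (D' + 2 * x) * Q) (sumOver-singleton w (deg (induced G S))) ⟩
      (D' + 2 * deg (induced G S) w) * Q
        ≡⟨ ℕₚ.*-distribʳ-+ Q D' (2 * deg (induced G S) w) ⟩
      D' * Q + 2 * deg (induced G S) w * Q  <⟨ ℕₚ.+-monoʳ-< (D' * Q) low ⟩
      D' * Q + P                   ≡⟨ ℕₚ.+-comm (D' * Q) P ⟩
      P + D' * Q                   ∎)
      where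
      open ℕₚ.≤-Reasoning
      c' D' : ℕ
      c' = count (S ∖ singleton w)
      D' = degreeSum (induced G (S ∖ singleton w))

    -- P * count S ≤ degreeSum (induced G S) * Q says that G[S] has average degree at least P / Q.
    MinDegreeCore : Set
    MinDegreeCore = Σ (Fin n → Bool) λ S → (∀ v → S v ≡ true → P ≤ 2 * deg (induced G S) v * Q)
                                         × 0 < degreeSum (induced G S)

    minDegreeCore : ∀ S → P * count S ≤ degreeSum (induced G S) * Q → 0 < P * count S → MinDegreeCore
    minDegreeCore S dense 0<P|S| = peel (count S) S ℕₚ.≤-refl dense (m<n*o⇒0<n _ Q (ℕₚ.<-≤-trans 0<P|S| dense))
      where
      peel : ∀ fuel S → count S ≤ fuel →
        P * count S ≤ degreeSum (induced G S) * Q → 0 < degreeSum (induced G S) → MinDegreeCore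
      peel fuel S bound dense pos with any? (λ v → (S v Bool.≟ true) ×-dec (2 * deg (induced G S) v * Q ℕ.<? P))
      ... | no noLow = S , (λ v Sv → ℕₚ.≮⇒≥ λ low → noLow (v , Sv , low)) , pos
      ... | yes (w , Sw , low) with fuel | subst (_≤ fuel) (count-remove S w Sw) bound
      ...   | suc fuel' | s≤s bound' =
        peel fuel' (S ∖ singleton w) bound' (ℕₚ.<⇒≤ dense') (m<n*o⇒0<n _ Q dense')
        where
        dense' : P * count (S ∖ singleton w) < degreeSum (induced G (S ∖ singleton w)) * Q
        dense' = removal-keeps-dense S w Sw low dense

  degreeSum-pos⇒count-pos : ∀ {n} (G : Graph n) S → 0 < degreeSum (induced G S) → 0 < count S
  degreeSum-pos⇒count-pos G S pos with sum-pos (deg (induced G S)) pos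
  ... | u , 0<deg with count-pos (adj (induced G S) u) 0<deg
  ...   | w , uw = subst (0 <_) (≡-sym (count-remove S u (induced-inside G S u w uw))) (s≤s z≤n)

  -- Capping the degrees of one colour class

  takeFirst : ∀ {n} → ℕ → (Fin n → Bool) → Fin n → Bool
  takeFirst zero    p i       = false
  takeFirst (suc t) p zero    = p zero
  takeFirst (suc t) p (suc i) = takeFirst (if p zero then t else suc t) (λ j → p (suc j)) i

  count-takeFirst : ∀ {n} t (p : Fin n → Bool) → count (takeFirst t p) ≡ t ⊓ count p
  count-takeFirst {zero}  t       p = ≡-sym (ℕₚ.⊓-zeroʳ t)
  count-takeFirst {suc n} zero    p = count-false n
  count-takeFirst {suc n} (suc t) p with p zero
  ... | true  = cong suc (count-takeFirst t (λ j → p (suc j)))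
  ... | false = count-takeFirst (suc t) (λ j → p (suc j))

  takeFirst-⊆ : ∀ {n} t (p : Fin n → Bool) i → takeFirst t p i ≡ true → p i ≡ true
  takeFirst-⊆ (suc t) p zero    taken = taken
  takeFirst-⊆ (suc t) p (suc i) taken = takeFirst-⊆ (if p zero then t else suc t) (λ j → p (suc j)) i taken

  inducedSubgraph : ∀ {n} {G : Graph n} (K : Graph n) → (∀ u v → adj K u v ≡ true → adj G u v ≡ true) →
    (Fin n → Bool) → Subgraph G
  inducedSubgraph K K⊆G T = record
    { inV  = T
    ; H    = induced K T
    ; sub  = λ u v uv → K⊆G u v (induced-⊆ K T u v uv)
    ; ends = induced-inside K T
    }

  module Capping {n} (G : Graph n) (side : Fin n → Bool)
    (crossing : ∀ u v → adj G u v ≡ true → side u ≢ side v) (S : Fin n → Bool) (t : ℕ) where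

    A B : Fin n → Bool
    A v = S v ∧ side v
    B v = S v ∧ not (side v)

    A⇒side : ∀ v → A v ≡ true → side v ≡ true
    A⇒side v Av = proj₂ (∧-true {S v} Av)

    B⇒¬side : ∀ v → B v ≡ true → side v ≡ false
    B⇒¬side v Bv with S v | side v | Bv
    ... | true | false | _ = refl

    GS : Graph n
    GS = induced G S

    keeps : Fin n → Fin n → Bool
    keeps u v = A u ∧ takeFirst t (adj GS u) v

    keeps-⊆ : ∀ u v → keeps u v ≡ true → adj GS u v ≡ true
    keeps-⊆ u v uv = takeFirst-⊆ t (adj GS u) v (proj₂ (∧-true uv))

    capped : Graph n
    capped = record
      { adj    = λ u v → keeps u v ∨ keeps v u
      ; sym    = λ u v → ∨-comm (keeps u v) (keeps v u)
      ; irrefl = λ v → loopless v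
      }
      where
      loopless : ∀ v → keeps v v ∨ keeps v v ≡ false
      loopless v with keeps v v in vv
      ... | false = refl
      ... | true with () ← trans (≡-sym (keeps-⊆ v v vv)) (irrefl GS v)

    capped-⊆ : ∀ u v → adj capped u v ≡ true → adj GS u v ≡ true
    capped-⊆ u v uv with keeps u v in kuv | keeps v u in kvu
    ... | true  | _    = keeps-⊆ u v kuv
    ... | false | true = trans (Graph.sym GS u v) (keeps-⊆ v u kvu)

    capped-crossing : ∀ u v → adj capped u v ≡ true → side u ≢ side v
    capped-crossing u v uv = crossing u v (induced-⊆ G S u v (capped-⊆ u v uv))

    capped-A∼B : ∀ u v → adj capped u v ≡ true → A u ≡ B v
    capped-A∼B u v uv
      rewrite induced-inside G S u v (capped-⊆ u v uv)
            | induced-inside G S v u (trans (Graph.sym GS v u) (capped-⊆ u v uv))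
      = ¬-not (capped-crossing u v uv)

    deg-capped-A : ∀ a → A a ≡ true → deg capped a ≡ t ⊓ deg GS a
    deg-capped-A a Aa = trans (count-cong only-kept) (count-takeFirst t (adj GS a))
      where
      not-kept : ∀ v → keeps v a ≡ false
      not-kept v with keeps v a in kva
      ... | false = refl
      ... | true = ⊥-elim (crossing v a (induced-⊆ G S v a (keeps-⊆ v a kva))
                     (trans (A⇒side v (proj₁ (∧-true {A v} kva))) (≡-sym (A⇒side a Aa))))
      only-kept : ∀ v → keeps a v ∨ keeps v a ≡ takeFirst t (adj GS a) v
      only-kept v rewrite not-kept v | Aa = ∨-identityʳ (takeFirst t (adj GS a) v)

    capped-degrees-balance : sumOver A (deg capped) ≡ sumOver B (deg capped)
    capped-degrees-balance = sumOver-deg-transfer capped A B capped-A∼B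

    module Trim (f : Fin n → Bool) (f⊆B : ∀ v → f v ≡ true → B v ≡ true) where

      T : Fin n → Bool
      T v = A v ∨ f v

      trimmed : Subgraph G
      trimmed = inducedSubgraph capped (λ u v uv → induced-⊆ G S u v (capped-⊆ u v uv)) T

      trimmed-crossing : ∀ u v → adj (H trimmed) u v ≡ true → side u ≢ side v
      trimmed-crossing u v uv = capped-crossing u v (induced-⊆ capped T u v uv)

      deg-trimmed-≤ : ∀ v → deg (H trimmed) v ≤ deg capped v
      deg-trimmed-≤ = deg-induced-≤ capped T

      deg-trimmed-f : ∀ v → f v ≡ true → deg (H trimmed) v ≡ deg capped v
      deg-trimmed-f v fv = deg-induced-closed capped T v (trans (cong (A v ∨_) fv) (∨-zeroʳ (A v))) neighbours-in-A
        where
        neighbours-in-A : ∀ w → adj capped v w ≡ true → T w ≡ true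
        neighbours-in-A w vw = cong (_∨ f w) (trans (capped-A∼B w v (trans (Graph.sym capped w v) vw)) (f⊆B v fv))

      f⇒¬side : ∀ v → f v ≡ true → side v ≡ false
      f⇒¬side v fv = B⇒¬side v (f⊆B v fv)

      edges-trimmed : edges (H trimmed) ≡ sumOver f (deg capped)
      edges-trimmed = trans (bipartite-edges≡sumOver-deg (H trimmed) side trimmed-crossing) (sum-cong-≗ pointwise)
        where
        pointwise : ∀ v → (if not (side v) then deg (H trimmed) v else 0) ≡ (if f v then deg capped v else 0)
        pointwise v = by-cases (f v) refl (side v) refl
          where
          lhs : ∀ {s} → side v ≡ s → (if not (side v) then deg (H trimmed) v else 0) ≡ (if not s then deg (H trimmed) v else 0)
          lhs = cong (λ s → if not s then deg (H trimmed) v else 0)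
          rhs : ∀ {b} → f v ≡ b → (if b then deg capped v else 0) ≡ (if f v then deg capped v else 0)
          rhs fv = cong (λ b → if b then deg capped v else 0) (≡-sym fv)
          by-cases : ∀ b → f v ≡ b → ∀ s → side v ≡ s →
            (if not (side v) then deg (H trimmed) v else 0) ≡ (if f v then deg capped v else 0)
          by-cases true  fv _     _  = trans (lhs (f⇒¬side v fv)) (trans (deg-trimmed-f v fv) (rhs fv))
          by-cases false fv true  sv = trans (lhs sv) (rhs fv)
          by-cases false fv false sv = trans (lhs sv) (trans (deg-induced-outside capped T v Tv≡false) (rhs fv))
            where
            Tv≡false : T v ≡ false
            Tv≡false = trans (cong (λ s → S v ∧ s ∨ f v) sv) (trans (cong (_∨ f v) (∧-zeroʳ (S v))) fv)

      trimmed-side : ∀ v → T v ∧ side v ≡ A v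
      trimmed-side v with f v in fv
      ... | true rewrite f⇒¬side v fv = trans (∧-zeroʳ (S v ∧ false ∨ true)) (≡-sym (∧-zeroʳ (S v)))
      ... | false with S v | side v
      ...   | true  | true  = refl
      ...   | true  | false = refl
      ...   | false | _     = refl

      trimmed-¬side : ∀ v → T v ∧ not (side v) ≡ f v
      trimmed-¬side v with f v in fv
      ... | true rewrite f⇒¬side v fv = trans (∧-identityʳ (S v ∧ false ∨ true)) (∨-zeroʳ (S v ∧ false))
      ... | false with S v | side v
      ...   | true  | true  = refl
      ...   | true  | false = refl
      ...   | false | _     = refl

      count-trimmed : count T ≡ count A + count f
      count-trimmed = trans (count-split T side) (cong₂ _+_ (count-cong trimmed-side) (count-cong trimmed-¬side))

  -- The lemma with denominators cleared

  -- k = P / Q, and A is the colour class where side holds.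
  record Witness {n} (G : Graph n) (P Q : ℕ) : Set where
    field
      subgraph : Subgraph G
      side     : Fin n → Bool
      crossing : ∀ u v → adj (H subgraph) u v ≡ true → side u ≢ side v
      nonempty : 0 < vH subgraph
      dense    : P * vH subgraph ≤ 8 * edges (H subgraph) * Q
      A-capped : ∀ v → inV subgraph v ∧ side v ≡ true → deg (H subgraph) v * Q ≤ P
      unbalanced-or-bounded :
        P ^ 6 * count (λ v → inV subgraph v ∧ not (side v)) ≤ count (λ v → inV subgraph v ∧ side v) * Q ^ 6
        ⊎ (∀ v → inV subgraph v ≡ true → deg (H subgraph) v * Q ^ 7 ≤ P ^ 7)

  module Construction {n} (G : Graph n) (P Q : ℕ) .{{_ : NonZero Q}} (Q≤P : Q ≤ P)
    (side : Fin n → Bool) (crossing : ∀ u v → adj G u v ≡ true → side u ≢ side v)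
    (S : Fin n → Bool) (minDeg : ∀ v → S v ≡ true → P ≤ 2 * deg (induced G S) v * Q)
    (B≤A : count (λ v → S v ∧ not (side v)) ≤ count (λ v → S v ∧ side v))
    (A≢∅ : 0 < count (λ v → S v ∧ side v)) where

    open Capping G side crossing S (P / Q)

    A-deg-≤ : ∀ v → A v ≡ true → Q * deg capped v ≤ P
    A-deg-≤ v Av = begin
      Q * deg capped v              ≡⟨ cong (Q *_) (deg-capped-A v Av) ⟩
      Q * ((P / Q) ⊓ deg GS v)      ≤⟨ ℕₚ.*-monoʳ-≤ Q (ℕₚ.m⊓n≤m (P / Q) (deg GS v)) ⟩
      Q * (P / Q)                   ≡⟨ ℕₚ.*-comm Q (P / Q) ⟩
      P / Q * Q                     ≤⟨ m/n*n≤m P Q ⟩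
      P                             ∎
      where open ℕₚ.≤-Reasoning

    A-deg-≥ : ∀ v → A v ≡ true → P ≤ (2 * Q) * deg capped v
    A-deg-≥ v Av = begin
      P                                       ≤⟨ ℕₚ.⊓-glb (m≤2n*[m/n] P Q Q≤P) P≤2Qd ⟩
      ((2 * Q) * (P / Q)) ⊓ ((2 * Q) * deg GS v)  ≡⟨ ℕₚ.*-distribˡ-⊓ (2 * Q) (P / Q) (deg GS v) ⟨
      (2 * Q) * ((P / Q) ⊓ deg GS v)              ≡⟨ cong ((2 * Q) *_) (deg-capped-A v Av) ⟨
      (2 * Q) * deg capped v                  ∎
      where
      open ℕₚ.≤-Reasoning
      P≤2Qd : P ≤ (2 * Q) * deg GS v
      P≤2Qd = subst (P ≤_) (solve 2 (λ d Q → con 2 :* d :* Q := (con 2 :* Q) :* d) refl (deg GS v) Q)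
                    (minDeg v (proj₁ (∧-true {S v} Av)))

    E : ℕ
    E = sumOver A (deg capped)

    PA≤2QE : P * count A ≤ (2 * Q) * E
    PA≤2QE = begin
      P * count A                       ≡⟨ sumOver-const A P ⟨
      sumOver A (λ _ → P)               ≤⟨ sumOver-mono A A-deg-≥ ⟩
      sumOver A (λ v → (2 * Q) * deg capped v) ≡⟨ sumOver-*ˡ A (2 * Q) (deg capped) ⟩
      (2 * Q) * E                       ∎
      where open ℕₚ.≤-Reasoning

    QE≤PA : Q * E ≤ P * count A
    QE≤PA = begin
      Q * E                             ≡⟨ sumOver-*ˡ A Q (deg capped) ⟨
      sumOver A (λ v → Q * deg capped v) ≤⟨ sumOver-mono A A-deg-≤ ⟩
      sumOver A (λ _ → P)               ≡⟨ sumOver-const A P ⟩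
      P * count A                       ∎
      where open ℕₚ.≤-Reasoning

    module _ (f : Fin n → Bool) (f⊆B : ∀ v → f v ≡ true → B v ≡ true) where
      open Trim f f⊆B

      trimmed-A-capped : ∀ v → T v ∧ side v ≡ true → deg (H trimmed) v * Q ≤ P
      trimmed-A-capped v Tv∧side = begin
        deg (H trimmed) v * Q  ≡⟨ ℕₚ.*-comm (deg (H trimmed) v) Q ⟩
        Q * deg (H trimmed) v  ≤⟨ ℕₚ.*-monoʳ-≤ Q (deg-trimmed-≤ v) ⟩
        Q * deg capped v       ≤⟨ A-deg-≤ v (trans (≡-sym (trimmed-side v)) Tv∧side) ⟩
        P                      ∎
        where open ℕₚ.≤-Reasoning

      witnessFor : P * (count A + count f) ≤ 8 * sumOver f (deg capped) * Q →
        (P ^ 6 * count f ≤ count A * Q ^ 6 ⊎ (∀ v → T v ≡ true → deg (H trimmed) v * Q ^ 7 ≤ P ^ 7)) →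
        Witness G P Q
      witnessFor dense′ alternative = record
        { subgraph = trimmed
        ; side     = side
        ; crossing = trimmed-crossing
        ; nonempty = subst (0 <_) (≡-sym count-trimmed) (ℕₚ.<-≤-trans A≢∅ (ℕₚ.m≤m+n (count A) (count f)))
        ; dense    = subst₂ (λ x y → P * x ≤ 8 * y * Q) (≡-sym count-trimmed) (≡-sym edges-trimmed) dense′
        ; A-capped = trimmed-A-capped
        ; unbalanced-or-bounded = Sum.map₁
            (subst₂ (λ x y → P ^ 6 * x ≤ y * Q ^ 6) (≡-sym (count-cong trimmed-¬side)) (≡-sym (count-cong trimmed-side)))
            alternative
        }

    high : Fin n → Bool
    high v = does (P ^ 7 ℕ.<? deg capped v * Q ^ 7)

    Bhi Blo : Fin n → Bool
    Bhi v = B v ∧ high v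
    Blo v = B v ∧ not (high v)

    Bhi⊆B : ∀ v → Bhi v ≡ true → B v ≡ true
    Bhi⊆B v Bhiv = proj₁ (∧-true {B v} Bhiv)

    Blo⊆B : ∀ v → Blo v ≡ true → B v ≡ true
    Blo⊆B v Blov = proj₁ (∧-true {B v} Blov)

    Ehi Elo : ℕ
    Ehi = sumOver Bhi (deg capped)
    Elo = sumOver Blo (deg capped)

    E≡Ehi+Elo : E ≡ Ehi + Elo
    E≡Ehi+Elo = trans capped-degrees-balance (sumOver-split B high (deg capped))

    lowCase : P * count A ≤ 4 * (Q * Elo) → Witness G P Q
    lowCase PA≤4QElo = witnessFor Blo Blo⊆B dense′ (inj₂ bounded)
      where
      open Trim Blo Blo⊆B
      dense′ : P * (count A + count Blo) ≤ 8 * Elo * Q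
      dense′ = begin
        P * (count A + count Blo)      ≤⟨ ℕₚ.*-monoʳ-≤ P (ℕₚ.+-monoʳ-≤ (count A) (ℕₚ.≤-trans (count-mono Blo⊆B) B≤A)) ⟩
        P * (count A + count A)        ≡⟨ ℕₚ.*-distribˡ-+ P (count A) (count A) ⟩
        P * count A + P * count A      ≤⟨ ℕₚ.+-mono-≤ PA≤4QElo PA≤4QElo ⟩
        4 * (Q * Elo) + 4 * (Q * Elo)  ≡⟨ solve 2 (λ Q e → con 4 :* (Q :* e) :+ con 4 :* (Q :* e) := con 8 :* e :* Q) refl Q Elo ⟩
        8 * Elo * Q                    ∎
        where open ℕₚ.≤-Reasoning
      bounded : ∀ v → T v ≡ true → deg (H trimmed) v * Q ^ 7 ≤ P ^ 7
      bounded v Tv = by-cases (A v) refl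
        where
        by-cases : ∀ b → A v ≡ b → deg (H trimmed) v * Q ^ 7 ≤ P ^ 7
        by-cases true Av = ℕₚ.≤-trans (ℕₚ.*-monoˡ-≤ (Q ^ 7) (deg-trimmed-≤ v)) (Qx≤P⇒xQ^≤P^ (A-deg-≤ v Av) Q≤P 6)
        by-cases false Av = subst (λ x → x * Q ^ 7 ≤ P ^ 7) (≡-sym (deg-trimmed-f v Blov))
                                  (ℕₚ.≮⇒≥ (not-does⇒¬ (P ^ 7 ℕ.<? deg capped v * Q ^ 7) (proj₂ (∧-true {B v} Blov))))
          where
          Blov : Blo v ≡ true
          Blov = trans (cong (_∨ Blo v) (≡-sym Av)) Tv

    highCase : ¬ (P * count A ≤ 4 * (Q * Elo)) → Witness G P Q
    highCase PA≰4QElo = witnessFor Bhi Bhi⊆B dense′ (inj₁ few)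
      where
      instance
        P≢0 : NonZero P
        P≢0 = ℕ.>-nonZero (ℕₚ.<-≤-trans (ℕₚ.n≢0⇒n>0 (ℕ.≢-nonZero⁻¹ Q)) Q≤P)
        Q⁶≢0 : NonZero (Q ^ 6)
        Q⁶≢0 = ℕₚ.m^n≢0 Q 6
      open ℕₚ.≤-Reasoning
      few : P ^ 6 * count Bhi ≤ count A * Q ^ 6
      few = ℕₚ.*-cancelˡ-≤ P (begin
        P * (P ^ 6 * count Bhi)                  ≡⟨ ℕₚ.*-assoc P (P ^ 6) (count Bhi) ⟨
        P ^ 7 * count Bhi                        ≡⟨ sumOver-const Bhi (P ^ 7) ⟨
        sumOver Bhi (λ _ → P ^ 7)                ≤⟨ sumOver-mono Bhi high-deg ⟩
        sumOver Bhi (λ v → Q ^ 7 * deg capped v) ≡⟨ sumOver-*ˡ Bhi (Q ^ 7) (deg capped) ⟩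
        Q ^ 7 * Ehi                              ≤⟨ ℕₚ.*-monoʳ-≤ (Q ^ 7) (ℕₚ.m≤m+n Ehi Elo) ⟩
        Q ^ 7 * (Ehi + Elo)                      ≡⟨ cong (Q ^ 7 *_) E≡Ehi+Elo ⟨
        Q ^ 7 * E                                ≡⟨ ℕₚ.*-assoc Q (Q ^ 6) E ⟩
        Q * (Q ^ 6 * E)                          ≡⟨ solve 3 (λ Q Q⁶ E → Q :* (Q⁶ :* E) := Q⁶ :* (Q :* E)) refl Q (Q ^ 6) E ⟩
        Q ^ 6 * (Q * E)                          ≤⟨ ℕₚ.*-monoʳ-≤ (Q ^ 6) QE≤PA ⟩
        Q ^ 6 * (P * count A)                    ≡⟨ solve 3 (λ Q⁶ P a → Q⁶ :* (P :* a) := P :* (a :* Q⁶)) refl (Q ^ 6) P (count A) ⟩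
        P * (count A * Q ^ 6)                    ∎)
        where
        high-deg : ∀ v → Bhi v ≡ true → P ^ 7 ≤ Q ^ 7 * deg capped v
        high-deg v Bhiv = subst (P ^ 7 ≤_) (ℕₚ.*-comm (deg capped v) (Q ^ 7))
          (ℕₚ.<⇒≤ (does⇒ (P ^ 7 ℕ.<? deg capped v * Q ^ 7) (proj₂ (∧-true {B v} Bhiv))))
      Bhi≤A : count Bhi ≤ count A
      Bhi≤A = ℕₚ.*-cancelʳ-≤ (count Bhi) (count A) (Q ^ 6) (begin
        count Bhi * Q ^ 6  ≡⟨ ℕₚ.*-comm (count Bhi) (Q ^ 6) ⟩
        Q ^ 6 * count Bhi  ≤⟨ ℕₚ.*-monoˡ-≤ (count Bhi) (ℕₚ.^-monoˡ-≤ 6 Q≤P) ⟩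
        P ^ 6 * count Bhi  ≤⟨ few ⟩
        count A * Q ^ 6    ∎)
      PA<4QEhi : P * count A < 4 * (Q * Ehi)
      PA<4QEhi = ℕₚ.+-cancelʳ-< (P * count A) (P * count A) (4 * (Q * Ehi)) (begin-strict
        P * count A + P * count A          ≤⟨ ℕₚ.+-mono-≤ PA≤2QE PA≤2QE ⟩
        (2 * Q) * E + (2 * Q) * E          ≡⟨ cong (λ x → (2 * Q) * x + (2 * Q) * x) E≡Ehi+Elo ⟩
        (2 * Q) * (Ehi + Elo) + (2 * Q) * (Ehi + Elo)
          ≡⟨ solve 3 (λ Q h l → (con 2 :* Q) :* (h :+ l) :+ (con 2 :* Q) :* (h :+ l)
                               := con 4 :* (Q :* h) :+ con 4 :* (Q :* l)) refl Q Ehi Elo ⟩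
        4 * (Q * Ehi) + 4 * (Q * Elo)      <⟨ ℕₚ.+-monoʳ-< (4 * (Q * Ehi)) (ℕₚ.≰⇒> PA≰4QElo) ⟩
        4 * (Q * Ehi) + P * count A        ∎)
      dense′ : P * (count A + count Bhi) ≤ 8 * Ehi * Q
      dense′ = begin
        P * (count A + count Bhi)      ≤⟨ ℕₚ.*-monoʳ-≤ P (ℕₚ.+-monoʳ-≤ (count A) Bhi≤A) ⟩
        P * (count A + count A)        ≡⟨ ℕₚ.*-distribˡ-+ P (count A) (count A) ⟩
        P * count A + P * count A      ≤⟨ ℕₚ.+-mono-≤ (ℕₚ.<⇒≤ PA<4QEhi) (ℕₚ.<⇒≤ PA<4QEhi) ⟩
        4 * (Q * Ehi) + 4 * (Q * Ehi)  ≡⟨ solve 2 (λ Q e → con 4 :* (Q :* e) :+ con 4 :* (Q :* e) := con 8 :* e :* Q) refl Q Ehi ⟩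
        8 * Ehi * Q                    ∎

    witness : Witness G P Q
    witness with P * count A ℕ.≤? 4 * (Q * Elo)
    ... | yes PA≤4QElo = lowCase PA≤4QElo
    ... | no PA≰4QElo  = highCase PA≰4QElo

  orient : ∀ {n} (G : Graph n) (S c : Fin n → Bool) → (∀ u v → adj G u v ≡ true → c u ≢ c v) →
    Σ (Fin n → Bool) λ side → (∀ u v → adj G u v ≡ true → side u ≢ side v)
                            × count (λ v → S v ∧ not (side v)) ≤ count (λ v → S v ∧ side v)
  orient G S c crossing with count (λ v → S v ∧ not (c v)) ℕ.≤? count (λ v → S v ∧ c v)
  ... | yes B≤A = c , crossing , B≤A
  ... | no B≰A  = (λ v → not (c v)) , (λ u v uv → crossing u v uv ∘ not-injective) ,
    subst (_≤ count (λ v → S v ∧ not (c v))) (count-cong λ v → cong (S v ∧_) (≡-sym (not-involutive (c v))))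
          (ℕₚ.<⇒≤ (ℕₚ.≰⇒> B≰A))

  witness : ∀ P q → suc q ≤ P → ∀ {n} (G : Graph n) → IsBipartite G → 0 < n →
    P * n ≤ 2 * edges G * suc q → Witness G P (suc q)
  witness P q Q≤P {n} G (c , crossing) 0<n dense
    with minDegreeCore G P (suc q) (λ _ → true)
           (subst₂ (λ x y → P * x ≤ y * suc q) (≡-sym (count-true n)) (≡-sym (handshake G)) dense)
           (ℕₚ.*-mono-< (ℕₚ.<-≤-trans (s≤s z≤n) Q≤P) (subst (0 <_) (≡-sym (count-true n)) 0<n))
  ... | S , minDeg , posS with orient G S c crossing
  ...   | side , crossing′ , B≤A =
    Construction.witness G P (suc q) Q≤P side crossing′ S minDeg B≤A
      (0<m+n∧n≤m⇒0<m (subst (0 <_) (count-split S side) (degreeSum-pos⇒count-pos G S posS)) B≤A)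

module Fractions where

  open import Data.Nat as ℕ using (ℕ; zero; suc; _+_; _*_; _≤_; _<_; _^_; z≤n; s≤s)
  import Data.Nat.Properties as ℕₚ
  open import Data.Nat.Solver using (module +-*-Solver)
  open +-*-Solver using (solve; _:*_; _:+_; con; _:=_)
  import Data.Integer as ℤ
  import Data.Integer.Properties as ℤₚ
  open import Data.Rational as ℚ using (ℚ; mkℚ; 0ℚ; toℚᵘ)
  import Data.Rational.Properties as ℚₚ
  open import Data.Rational.Unnormalised as ℚᵘ using (mkℚᵘ)
  import Data.Rational.Unnormalised.Properties as ℚᵘₚ
  open import Data.Product using (Σ; _×_; _,_)
  open import Data.Empty using (⊥-elim)
  open import Relation.Binary.PropositionalEquality using (_≡_; refl; cong; trans; subst; subst₂) renaming (sym to ≡-sym)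

  -- x = a / (1 + b), following the denominator convention of mkℚᵘ
  IsFraction : ℚ → ℕ → ℕ → Set
  IsFraction x a b = toℚᵘ x ℚᵘ.≃ mkℚᵘ (ℤ.+ a) b

  fraction-/ : ∀ a b → IsFraction ((ℤ.+ a) ℚ./ suc b) a b
  fraction-/ a b = ℚₚ.toℚᵘ-fromℚᵘ (mkℚᵘ (ℤ.+ a) b)

  fraction-ℕ : ∀ a → IsFraction (ℕ→ℚ a) a 0
  fraction-ℕ a = fraction-/ a 0

  fraction-* : ∀ {x y a b c e} → IsFraction x a b → IsFraction y c e →
    IsFraction (x ℚ.* y) (a * c) (e + b * suc e)
  fraction-* {x} {y} {a} {b} {c} {e} x≃ y≃ =
    ℚᵘₚ.≃-trans (ℚₚ.toℚᵘ-homo-* x y)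
      (ℚᵘₚ.≃-trans (ℚᵘₚ.*-cong x≃ y≃)
        (ℚᵘₚ.≃-reflexive (cong (λ z → mkℚᵘ z (e + b * suc e)) (≡-sym (ℤₚ.pos-* a c)))))

  fraction-^ : ∀ {x a b} → IsFraction x a b → ∀ m →
    Σ ℕ λ b′ → suc b′ ≡ suc b ^ m × IsFraction (x ^ℚ m) (a ^ m) b′
  fraction-^ x≃ zero = 0 , refl , fraction-/ 1 0
  fraction-^ {b = b} x≃ (suc m) with fraction-^ x≃ m
  ... | b′ , b′≡ , xᵐ≃ = b′ + b * suc b′ , cong (suc b *_) b′≡ , fraction-* x≃ xᵐ≃

  fraction-≤⁻ : ∀ {x y a b c e} → IsFraction x a b → IsFraction y c e → x ℚ.≤ y → a * suc e ≤ c * suc b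
  fraction-≤⁻ {x} {y} {a} {b} {c} {e} x≃ y≃ x≤y
    with ℚᵘₚ.≤-respʳ-≃ y≃ (ℚᵘₚ.≤-respˡ-≃ x≃ (ℚₚ.toℚᵘ-mono-≤ x≤y))
  ... | ℚᵘ.*≤* ae≤cb = ℤₚ.drop‿+≤+ (subst₂ ℤ._≤_ (≡-sym (ℤₚ.pos-* a (suc e))) (≡-sym (ℤₚ.pos-* c (suc b))) ae≤cb)

  fraction-≤ : ∀ {x y a b c e} → IsFraction x a b → IsFraction y c e → a * suc e ≤ c * suc b → x ℚ.≤ y
  fraction-≤ {x} {y} {a} {b} {c} {e} x≃ y≃ ae≤cb =
    ℚₚ.toℚᵘ-cancel-≤ (ℚᵘₚ.≤-respʳ-≃ (ℚᵘₚ.≃-sym y≃) (ℚᵘₚ.≤-respˡ-≃ (ℚᵘₚ.≃-sym x≃)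
      (ℚᵘ.*≤* (subst₂ ℤ._≤_ (ℤₚ.pos-* a (suc e)) (ℤₚ.pos-* c (suc b)) (ℤ.+≤+ ae≤cb)))))

  nonNegative-fraction : ∀ k → 0ℚ ℚ.≤ k → Σ ℕ λ a → Σ ℕ λ b → IsFraction k a b
  nonNegative-fraction (mkℚ (ℤ.+ a) b _) _ = a , b , ℚᵘₚ.≃-refl
  nonNegative-fraction k@(mkℚ ℤ.-[1+ _ ] _ _) 0≤k = ⊥-elim (ℤ.NonNegative.nonNeg (ℚ.nonNegative {k} 0≤k))

  module _ {k P q} (k≃ : IsFraction k P q) where

    ℕ≤k : ∀ x → x * suc q ≤ P → ℕ→ℚ x ℚ.≤ k
    ℕ≤k x xQ≤P = fraction-≤ (fraction-ℕ x) k≃ (subst (x * suc q ≤_) (≡-sym (ℕₚ.*-identityʳ P)) xQ≤P)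

    ℕ≤k^ : ∀ m x → x * suc q ^ m ≤ P ^ m → ℕ→ℚ x ℚ.≤ k ^ℚ m
    ℕ≤k^ m x xQᵐ≤Pᵐ with fraction-^ k≃ m
    ... | b , b≡Qᵐ , kᵐ≃ = fraction-≤ (fraction-ℕ x) kᵐ≃
      (subst₂ _≤_ (cong (x *_) (≡-sym b≡Qᵐ)) (≡-sym (ℕₚ.*-identityʳ (P ^ m))) xQᵐ≤Pᵐ)

    k^*ℕ≤ℕ : ∀ m x y → P ^ m * x ≤ y * suc q ^ m → (k ^ℚ m) ℚ.* ℕ→ℚ x ℚ.≤ ℕ→ℚ y
    k^*ℕ≤ℕ m x y Pᵐx≤yQᵐ with fraction-^ k≃ m
    ... | b , b≡Qᵐ , kᵐ≃ = fraction-≤ (fraction-* kᵐ≃ (fraction-ℕ x)) (fraction-ℕ y)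
      (subst₂ _≤_ (≡-sym (ℕₚ.*-identityʳ (P ^ m * x))) (cong (y *_) (trans (≡-sym b≡Qᵐ) (cong suc (≡-sym (ℕₚ.*-identityʳ b))))) Pᵐx≤yQᵐ)

    k/4≤avgDeg : ∀ e m → 0 < m → P * m ≤ 8 * e * suc q → ((ℤ.+ 1) ℚ./ 4) ℚ.* k ℚ.≤ avgDeg e m
    k/4≤avgDeg e (suc m) _ Pm≤8eQ = fraction-≤ (fraction-* (fraction-/ 1 3) k≃) (fraction-/ (2 * e) m)
      (subst₂ _≤_ (cong (_* suc m) (≡-sym (ℕₚ.*-identityˡ P)))
                  (solve 2 (λ e Q → con 8 :* e :* Q := (con 2 :* e) :* (Q :+ con 3 :* Q)) refl e (suc q))
                  Pm≤8eQ)

  fraction-of-≥2 : ∀ k → (ℤ.+ 2) ℚ./ 1 ℚ.≤ k → Σ ℕ λ P → Σ ℕ λ q → IsFraction k P q × suc q ≤ P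
  fraction-of-≥2 k 2≤k with nonNegative-fraction k (ℚₚ.≤-trans (fraction-≤ (fraction-/ 0 0) (fraction-/ 2 0) z≤n) 2≤k)
  ... | P , q , k≃ = P , q , k≃ , ℕₚ.≤-trans (ℕₚ.m≤m+n (suc q) _) (subst (2 * suc q ≤_) (ℕₚ.*-identityʳ P) 2Q≤P)
    where
    2Q≤P : 2 * suc q ≤ P * 1
    2Q≤P = fraction-≤⁻ (fraction-/ 2 0) k≃ 2≤k

  ≤d⇒dense : ∀ {k P q} → IsFraction k P q → suc q ≤ P → ∀ {n} (G : Graph n) → k ℚ.≤ d G →
    0 < n × P * n ≤ 2 * edges G * suc q
  ≤d⇒dense k≃ Q≤P {zero} G k≤0 =
    ⊥-elim (ℕₚ.<-irrefl refl (ℕₚ.<-≤-trans (s≤s z≤n) (ℕₚ.≤-trans Q≤P (subst (_≤ 0) (ℕₚ.*-identityʳ _) (fraction-≤⁻ k≃ (fraction-/ 0 0) k≤0)))))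
  ≤d⇒dense k≃ Q≤P {suc m} G k≤dG = s≤s z≤n , fraction-≤⁻ k≃ (fraction-/ (2 * edges G) m) k≤dG

open import Data.Bool using (Bool; true; false; _∧_; not)
open import Data.Nat using (ℕ)
open import Data.Fin using (Fin)
open import Data.Integer using (+_)
open import Data.Rational using (ℚ; _≤_; _*_; _/_)
open import Data.Product using (Σ; _×_; _,_; uncurry)
open import Data.Sum as Sum using (_⊎_)
open import Relation.Binary.PropositionalEquality using (_≡_; _≢_)
open Combinatorics using (Witness; witness)
open Fractions


lemma3p1 : (k : ℚ) → ((+ 2) / 1) ≤ k →
    ∀ {n} (G : Graph n) → IsBipartite G → k ≤ d G →
    Σ (Subgraph G) λ S → Σ (Fin n → Bool) λ side →
      (∀ u v → adj (H S) u v ≡ true → side u ≢ side v) ×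
      (((+ 1) / 4) * k ≤ dH S) ×
      (∀ v → inV S v ∧ side v ≡ true → ℕ→ℚ (deg (H S) v) ≤ k) ×
      ((k ^ℚ 6) * ℕ→ℚ (count (λ v → inV S v ∧ not (side v)))
          ≤ ℕ→ℚ (count (λ v → inV S v ∧ side v))
        ⊎ (∀ v → inV S v ≡ true → ℕ→ℚ (deg (H S) v) ≤ k ^ℚ 7))
lemma3p1 k 2≤k G bip k≤dG with fraction-of-≥2 k 2≤k
... | P , q , k≃ , Q≤P =
  subgraph , side , crossing ,
  k/4≤avgDeg k≃ (edges (H subgraph)) (vH subgraph) nonempty dense ,
  (λ v Av → ℕ≤k k≃ (deg (H subgraph) v) (A-capped v Av)) ,
  Sum.map (k^*ℕ≤ℕ k≃ 6 (count (λ v → inV subgraph v ∧ not (side v))) (count (λ v → inV subgraph v ∧ side v)))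
          (λ bounded v Vv → ℕ≤k^ k≃ 7 (deg (H subgraph) v) (bounded v Vv))
          unbalanced-or-bounded
  where open Witness (uncurry (witness P q Q≤P G bip) (≤d⇒dense k≃ Q≤P G k≤dG))
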